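{- Let $n,m,p\geq1$, $\vec{u}_1,\vec{u}_2\in\widehat{\mathbb{N}}^n$, $\vec{v}_1,\vec{v}_2\in\widehat{\mathbb{N}}^m$, $\vec{w}_1,\vec{w}_2\in\widehat{\mathbb{N}}^p$. Then ($\vec{u}_1\leq\vec{u}_2$, $\vec{v}_1\leq\vec{v}_2$ and $\vec{w}_1\leq\vec{w}_2$) if and only if $\vec{u}_1\nearrow\vec{v}_1\nwarrow\vec{w}_1\leq\vec{u}_2\nearrow\vec{v}_2\nwarrow\vec{w}_2$, and if one of the three inequalities on the left is strict then the inequality on the right is strict. Moreover, $\vec{v}\nearrow\vec{w}\leq\vec{v}\nwarrow\vec{w}$ for all $\vec v\in\widehat{\mathbb{N}}^n$, $\vec w\in\widehat{\mathbb{N}}^m$.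
   Context: $Y_n$ is the set of planar rooted binary trees with $n$ internal vertices, identified with complete parenthesizations of $x_1\cdots x_{n+1}$ (each product of two factors written $(AB)$). The name of $\tau\in Y_n$ is $(v_1,\ldots,v_n)$: $v_i=i$ if $x_i$ is immediately preceded by a left parenthesis; otherwise $x_i$ is immediately followed by a nonempty block of right parentheses and $v_i=j$ where $x_j$ is the first variable after the left parenthesis matched with the last right parenthesis of that block. $\widehat{\mathbb{N}}^n$ is the set of names of trees in $Y_n$, ordered componentwise ($\vec a\le\vec b$ iff $a_i\le b_i$ for all $i$). For $\vec v\in\widehat{\mathbb{N}}^n$, $\vec w\in\widehat{\mathbb{N}}^m$: $\vec v\nearrow\vec w:=(v_1,\ldots,v_n,n\triangleright\vec w)$ and $\vec v\nwarrow\vec w:=(v_1,\ldots,v_n,w_1+n,\ldots,w_m+n)$, where $n\triangleright\vec w:=(n\tilde+w_1,\ldots,n\tilde+w_m)$ with $n\tilde+1:=1$ and $n\tilde+a:=n+a$ for $a\ne1$. These operations are associative and satisfy $(\vec u\nearrow\vec v)\nwarrow\vec w=\vec u\nearrow(\vec v\nwarrow\vec w)$, so $\vec u\nearrow\vec v\nwarrow\vec w$ is unambiguous. -}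

module Defs where

open import Data.Nat using (ℕ; zero; suc; _+_; _≤_; _≟_)
open import Data.List using (List; []; _∷_; _++_; [_])
open import Data.Vec using (Vec; tabulate; map) renaming (_++_ to _++ᵛ_)
open import Data.Fin using (toℕ)
open import Data.Product using (Σ; ∃; _×_)
open import Relation.Nullary using (yes; no; ¬_)
open import Relation.Binary.PropositionalEquality using (_≡_)
open import Data.Vec.Relation.Binary.Pointwise.Inductive using (Pointwise)

-- Planar rooted binary trees, indexed by the number of internal vertices.
data Tree : ℕ → Set where
  leaf : Tree 0
  node : ∀ {a b} → Tree a → Tree b → Tree (suc (a + b))

data Tok : Set where
  lp rp : Tok
  var   : ℕ → Tok

-- Parenthesization of x_{k+1} ⋯ x_{k+leaves}: a product of two factors is (AB).
toks : ∀ {n} → Tree n → ℕ → List Tok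
toks leaf k = [ var (suc k) ]
toks (node {a} A B) k = lp ∷ toks A k ++ toks B (k + suc a) ++ [ rp ]

countRP : List Tok → ℕ
countRP (rp ∷ ts) = suc (countRP ts)
countRP _ = 0

-- Scan backwards (list given nearest-first) from the last right parenthesis of
-- a block, with current nesting depth d, to its matching left parenthesis,
-- remembering the last variable seen (= first variable after that left parenthesis).
scan : ℕ → ℕ → List Tok → ℕ
scan d c [] = 0
scan d c (var j ∷ ts) = scan d j ts
scan d c (rp ∷ ts) = scan (suc d) c ts
scan zero c (lp ∷ ts) = 0
scan (suc zero) c (lp ∷ ts) = c
scan (suc (suc d)) c (lp ∷ ts) = scan (suc d) c ts

-- value of v_i given the tokens before x_i (reversed) and after x_i
value : ℕ → List Tok → List Tok → ℕ
value i (lp ∷ _) post = i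
value i pre post with countRP post
... | zero = 0
... | suc k = scan (suc k) i pre

locate : ℕ → List Tok → List Tok → ℕ
locate i acc [] = 0
locate i acc (var j ∷ ts) with j ≟ i
... | yes _ = value i acc ts
... | no _ = locate i (var j ∷ acc) ts
locate i acc (lp ∷ ts) = locate i (lp ∷ acc) ts
locate i acc (rp ∷ ts) = locate i (rp ∷ acc) ts

name : ∀ {n} → Tree n → Vec ℕ n
name {n} τ = tabulate (λ i → locate (suc (toℕ i)) [] (toks τ 0))

IsName : ∀ {n} → Vec ℕ n → Set
IsName {n} v = Σ (Tree n) (λ τ → name τ ≡ v)

_≤ᵛ_ : ∀ {n} → Vec ℕ n → Vec ℕ n → Set
_≤ᵛ_ = Pointwise _≤_

_<ᵛ_ : ∀ {n} → Vec ℕ n → Vec ℕ n → Set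
a <ᵛ b = a ≤ᵛ b × ¬ (a ≡ b)

_~+_ : ℕ → ℕ → ℕ
n ~+ suc zero = 1
n ~+ a = n + a

_▷_ : ∀ {m} → ℕ → Vec ℕ m → Vec ℕ m
n ▷ w = map (n ~+_) w

infixl 5 _↗_ _↖_
infix 4 _≤ᵛ_ _<ᵛ_

_↗_ : ∀ {n m} → Vec ℕ n → Vec ℕ m → Vec ℕ (n + m)
_↗_ {n} v w = v ++ᵛ (n ▷ w)

_↖_ : ∀ {n m} → Vec ℕ n → Vec ℕ m → Vec ℕ (n + m)
_↖_ {n} v w = v ++ᵛ map (λ a → a + n) w

{-# OPTIONS --safe #-}
-- Concatenation preserves and reflects the componentwise order blockwise, the shift a ↦ a + N
-- is an order embedding, and so is a ↦ N ~+ a on positive integers (it fixes 1 and sends every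
-- a ≥ 2 to N + a ≥ 2). Hence only the positivity of the middle names v₁, v₂ is needed, and it
-- holds because scanning back from x_i over its block of right parentheses always reaches the
-- matching left parenthesis. Strictness follows by reflecting the reverse inequality.
module Submission where

open import Defs
open import Data.Nat using (ℕ; zero; suc; _+_; _≤_; _<_; z≤n; s≤s; _≟_)
open import Data.Nat.Properties
open import Data.List using (List; []; _∷_; _++_; [_]; replicate; _ʳ++_)
open import Data.List.Properties using (++-assoc; ++-identityʳ; ++-ʳ++)
open import Data.Vec using (Vec; []; _∷_; map)
open import Data.Vec.Relation.Unary.All using (All; []; _∷_)
open import Data.Vec.Relation.Unary.All.Properties using (tabulate⁺)
open import Data.Vec.Relation.Binary.Pointwise.Inductive as Pointwise
  using ([]; _∷_; ++⁺; ++⁻; map⁺)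
open import Data.Fin.Properties using (toℕ<n)
open import Data.Product using (_×_; _,_)
open import Data.Sum using (_⊎_; inj₁; inj₂)
open import Data.Empty using (⊥; ⊥-elim)
open import Relation.Nullary using (yes; no)
open import Relation.Binary using (Tri; tri<; tri≈; tri>)
open import Relation.Binary.PropositionalEquality
  using (_≡_; refl; sym; trans; cong; cong₂; subst; module ≡-Reasoning)
open import Function.Bundles using (_⇔_; mk⇔)

open ≡-Reasoning

private variable
  a b n m p : ℕ
  A : Set

replicate-∷-++ : ∀ s (x : A) xs → replicate s x ++ x ∷ xs ≡ x ∷ replicate s x ++ xs
replicate-∷-++ zero    x xs = refl
replicate-∷-++ (suc s) x xs = cong (x ∷_) (replicate-∷-++ s x xs)

countRP-replicate : ∀ s ts → countRP (replicate s rp ++ ts) ≡ s + countRP ts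
countRP-replicate zero    ts = refl
countRP-replicate (suc s) ts = cong suc (countRP-replicate s ts)

+-suc-suc : ∀ k a b → k + suc a + suc b ≡ k + suc (suc (a + b))
+-suc-suc k a b = trans (+-assoc k (suc a) (suc b)) (cong (λ c → k + suc c) (+-suc a b))

spine : Tree n → ℕ
spine leaf       = 0
spine (node A B) = suc (spine B)

-- toks τ k ≡ prefix τ k ++ var (k + suc n) ∷ replicate (spine τ) rp
prefix : Tree n → ℕ → List Tok
prefix leaf           k = []
prefix (node {a} A B) k = lp ∷ toks A k ++ prefix B (k + suc a)

toks-node-++ : (A : Tree a) (B : Tree b) (k : ℕ) (r : List Tok) →
               toks (node A B) k ++ r ≡ lp ∷ toks A k ++ toks B (k + suc a) ++ rp ∷ r
toks-node-++ {a} A B k r = cong (lp ∷_) (begin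
  (toks A k ++ toks B (k + suc a) ++ [ rp ]) ++ r   ≡⟨ ++-assoc (toks A k) _ r ⟩
  toks A k ++ (toks B (k + suc a) ++ [ rp ]) ++ r   ≡⟨ cong (toks A k ++_) (++-assoc (toks B _) [ rp ] r) ⟩
  toks A k ++ toks B (k + suc a) ++ rp ∷ r          ∎)

toks-node-ʳ++ : (A : Tree a) (B : Tree b) (k : ℕ) (acc : List Tok) →
                toks (node A B) k ʳ++ acc ≡ rp ∷ toks B (k + suc a) ʳ++ toks A k ʳ++ lp ∷ acc
toks-node-ʳ++ A B k acc = trans (++-ʳ++ (toks A k)) (++-ʳ++ (toks B _))

countRP-toks-++ : (τ : Tree n) (k : ℕ) (r : List Tok) → countRP (toks τ k ++ r) ≡ 0
countRP-toks-++ leaf       k r = refl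
countRP-toks-++ (node A B) k r = refl

scan-toks : (τ : Tree n) (k d c : ℕ) (acc : List Tok) →
            scan (suc d) c (toks τ k ʳ++ acc) ≡ scan (suc d) (suc k) acc
scan-toks leaf           k d c acc = refl
scan-toks (node {a} A B) k d c acc = begin
  scan (suc d) c (toks (node A B) k ʳ++ acc)
    ≡⟨ cong (scan (suc d) c) (toks-node-ʳ++ A B k acc) ⟩
  scan (suc (suc d)) c (toks B (k + suc a) ʳ++ toks A k ʳ++ lp ∷ acc)
    ≡⟨ scan-toks B (k + suc a) (suc d) c _ ⟩
  scan (suc (suc d)) (suc (k + suc a)) (toks A k ʳ++ lp ∷ acc)
    ≡⟨ scan-toks A k (suc d) _ (lp ∷ acc) ⟩
  scan (suc d) (suc k) acc
    ∎

scan-prefix : (τ : Tree n) (k d : ℕ) (acc : List Tok) →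
              scan (spine τ + suc d) (k + suc n) (prefix τ k ʳ++ acc) ≡ scan (suc d) (suc k) acc
scan-prefix leaf k d acc = cong (λ c → scan (suc d) c acc) (+-comm k 1)
scan-prefix (node {a} {b} A B) k d acc = begin
  scan (suc (spine B) + suc d) (k + suc (suc (a + b))) (prefix (node A B) k ʳ++ acc)
    ≡⟨ cong (scan (suc (spine B) + suc d) (k + suc (suc (a + b)))) (++-ʳ++ (toks A k)) ⟩
  scan (suc (spine B) + suc d) (k + suc (suc (a + b))) (prefix B (k + suc a) ʳ++ toks A k ʳ++ lp ∷ acc)
    ≡⟨ cong₂ (λ e c → scan e c (prefix B (k + suc a) ʳ++ toks A k ʳ++ lp ∷ acc))
             (sym (+-suc (spine B) (suc d))) (sym (+-suc-suc k a b)) ⟩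
  scan (spine B + suc (suc d)) (k + suc a + suc b) (prefix B (k + suc a) ʳ++ toks A k ʳ++ lp ∷ acc)
    ≡⟨ scan-prefix B (k + suc a) (suc d) _ ⟩
  scan (suc (suc d)) (suc (k + suc a)) (toks A k ʳ++ lp ∷ acc)
    ≡⟨ scan-toks A k (suc d) _ (lp ∷ acc) ⟩
  scan (suc d) (suc k) acc
    ∎

locate-skip : (τ : Tree n) (k : ℕ) {i : ℕ} → k + suc n < i → (acc r : List Tok) →
              locate i acc (toks τ k ++ r) ≡ locate i (toks τ k ʳ++ acc) r
locate-skip leaf k {i} k+1<i acc r with suc k ≟ i
... | yes refl = ⊥-elim (<-irrefl (+-comm k 1) k+1<i)
... | no _     = refl
locate-skip (node {a} {b} A B) k {i} last<i acc r = begin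
  locate i acc (toks (node A B) k ++ r)
    ≡⟨ cong (locate i acc) (toks-node-++ A B k r) ⟩
  locate i (lp ∷ acc) (toks A k ++ toks B (k + suc a) ++ rp ∷ r)
    ≡⟨ locate-skip A k (≤-<-trans (+-monoʳ-≤ k (s≤s (≤-trans (m≤m+n a b) (n≤1+n _)))) last<i) _ _ ⟩
  locate i (toks A k ʳ++ lp ∷ acc) (toks B (k + suc a) ++ rp ∷ r)
    ≡⟨ locate-skip B (k + suc a) (subst (_< i) (sym (+-suc-suc k a b)) last<i) _ _ ⟩
  locate i (rp ∷ toks B (k + suc a) ʳ++ toks A k ʳ++ lp ∷ acc) r
    ≡⟨ cong (λ pre → locate i pre r) (sym (toks-node-ʳ++ A B k acc)) ⟩
  locate i (toks (node A B) k ʳ++ acc) r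
    ∎

locate-last : (τ : Tree n) (k : ℕ) (acc r : List Tok) →
              locate (k + suc n) acc (toks τ k ++ r)
                ≡ value (k + suc n) (prefix τ k ʳ++ acc) (replicate (spine τ) rp ++ r)
locate-last leaf k acc r with suc k ≟ k + 1
... | yes _   = refl
... | no k+1≢ = ⊥-elim (k+1≢ (+-comm 1 k))
locate-last (node {a} {b} A B) k acc r = begin
  locate i acc (toks (node A B) k ++ r)
    ≡⟨ cong (locate i acc) (toks-node-++ A B k r) ⟩
  locate i (lp ∷ acc) (toks A k ++ toks B (k + suc a) ++ rp ∷ r)
    ≡⟨ locate-skip A k (+-monoʳ-< k (s≤s (s≤s (m≤m+n a b)))) _ _ ⟩
  locate i (toks A k ʳ++ lp ∷ acc) (toks B (k + suc a) ++ rp ∷ r)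
    ≡⟨ cong (λ j → locate j (toks A k ʳ++ lp ∷ acc) (toks B (k + suc a) ++ rp ∷ r)) (sym (+-suc-suc k a b)) ⟩
  locate (k + suc a + suc b) (toks A k ʳ++ lp ∷ acc) (toks B (k + suc a) ++ rp ∷ r)
    ≡⟨ locate-last B (k + suc a) _ (rp ∷ r) ⟩
  value (k + suc a + suc b) (prefix B (k + suc a) ʳ++ toks A k ʳ++ lp ∷ acc) (replicate (spine B) rp ++ rp ∷ r)
    ≡⟨ cong₂ (λ j pre → value j pre (replicate (spine B) rp ++ rp ∷ r))
             (+-suc-suc k a b) (sym (++-ʳ++ (toks A k))) ⟩
  value i (prefix (node A B) k ʳ++ acc) (replicate (spine B) rp ++ rp ∷ r)
    ≡⟨ cong (value i (prefix (node A B) k ʳ++ acc)) (replicate-∷-++ (spine B) rp r) ⟩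
  value i (prefix (node A B) k ʳ++ acc) (replicate (spine (node A B)) rp ++ r)
    ∎
  where
  i : ℕ
  i = k + suc (suc (a + b))

value-positive : ∀ {i c} pre {post} → 1 ≤ i → countRP post ≡ suc c →
                 1 ≤ scan (suc c) i pre → 1 ≤ value i pre post
value-positive (lp ∷ _)    1≤i _  _ = 1≤i
value-positive []          _   eq s rewrite eq = s
value-positive (rp ∷ _)    _   eq s rewrite eq = s
value-positive (var _ ∷ _) _   eq s rewrite eq = s

-- In (A B) the last variable of A closes the block ending at the root of A, or is x_{k+1} itself.
locate-lastOfLeft-positive : (A : Tree a) (k : ℕ) (acc r : List Tok) → countRP r ≡ 0 →
                             1 ≤ locate (k + suc a) (lp ∷ acc) (toks A k ++ r)
locate-lastOfLeft-positive A k acc r countRP-r≡0 =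
  subst (1 ≤_) (sym (locate-last A k (lp ∷ acc) r)) (value-lastOfLeft-positive A)
  where
  value-lastOfLeft-positive : (A : Tree a) →
    1 ≤ value (k + suc a) (prefix A k ʳ++ lp ∷ acc) (replicate (spine A) rp ++ r)
  value-lastOfLeft-positive leaf = m≤n+m 1 k
  value-lastOfLeft-positive (node {a₁} {a₂} A₁ A₂) =
    value-positive (prefix (node A₁ A₂) k ʳ++ lp ∷ acc) (≤-trans (s≤s z≤n) (m≤n+m _ k)) block-length
      (subst (1 ≤_) (sym scan-to-root) (s≤s z≤n))
    where
    block-length : countRP (replicate (suc (spine A₂)) rp ++ r) ≡ suc (spine A₂)
    block-length = cong suc (begin
      countRP (replicate (spine A₂) rp ++ r) ≡⟨ countRP-replicate (spine A₂) r ⟩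
      spine A₂ + countRP r                  ≡⟨ cong (spine A₂ +_) countRP-r≡0 ⟩
      spine A₂ + 0                          ≡⟨ +-identityʳ _ ⟩
      spine A₂                              ∎)
    scan-to-root : scan (suc (spine A₂)) (k + suc (suc (a₁ + a₂))) (prefix (node A₁ A₂) k ʳ++ lp ∷ acc)
                   ≡ suc k
    scan-to-root = begin
      scan (suc (spine A₂)) (k + suc (suc (a₁ + a₂))) (prefix (node A₁ A₂) k ʳ++ lp ∷ acc)
        ≡⟨ cong₂ (λ e pre → scan e (k + suc (suc (a₁ + a₂))) pre)
                 (+-comm 1 (spine A₂)) (++-ʳ++ (toks A₁ k)) ⟩
      scan (spine A₂ + 1) (k + suc (suc (a₁ + a₂))) (prefix A₂ (k + suc a₁) ʳ++ toks A₁ k ʳ++ lp ∷ lp ∷ acc)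
        ≡⟨ cong (λ j → scan (spine A₂ + 1) j (prefix A₂ (k + suc a₁) ʳ++ toks A₁ k ʳ++ lp ∷ lp ∷ acc))
                (sym (+-suc-suc k a₁ a₂)) ⟩
      scan (spine A₂ + 1) (k + suc a₁ + suc a₂) (prefix A₂ (k + suc a₁) ʳ++ toks A₁ k ʳ++ lp ∷ lp ∷ acc)
        ≡⟨ scan-prefix A₂ (k + suc a₁) 0 _ ⟩
      scan 1 (suc (k + suc a₁)) (toks A₁ k ʳ++ lp ∷ lp ∷ acc)
        ≡⟨ scan-toks A₁ k 0 _ (lp ∷ lp ∷ acc) ⟩
      suc k
        ∎

locate-positive : (τ : Tree n) (k : ℕ) {i : ℕ} → k < i → i ≤ k + n → (acc r : List Tok) →
                  1 ≤ locate i acc (toks τ k ++ r)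
locate-positive leaf k k<i i≤k+0 acc r =
  ⊥-elim (<-irrefl refl (≤-trans k<i (subst (_ ≤_) (+-identityʳ k) i≤k+0)))
locate-positive (node {a} {b} A B) k {i} k<i i≤k+n acc r =
  subst (1 ≤_) (sym (cong (locate i acc) (toks-node-++ A B k r))) (inside (<-cmp i (k + suc a)))
  where
  inside : Tri (i < k + suc a) (i ≡ k + suc a) (k + suc a < i) →
           1 ≤ locate i (lp ∷ acc) (toks A k ++ toks B (k + suc a) ++ rp ∷ r)
  inside (tri< i<k+1+a _ _) =
    locate-positive A k k<i (≤-pred (subst (i <_) (+-suc k a) i<k+1+a)) (lp ∷ acc) _
  inside (tri≈ _ refl _) =
    locate-lastOfLeft-positive A k acc _ (countRP-toks-++ B (k + suc a) (rp ∷ r))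
  inside (tri> _ _ k+1+a<i) =
    subst (1 ≤_) (sym (locate-skip A k k+1+a<i (lp ∷ acc) _))
      (locate-positive B (k + suc a) k+1+a<i (subst (i ≤_) (sym (+-assoc k (suc a) b)) i≤k+n) _ (rp ∷ r))

name-positive : (τ : Tree n) → All (1 ≤_) (name τ)
name-positive τ = tabulate⁺ λ i →
  subst (λ ts → 1 ≤ locate _ [] ts) (++-identityʳ (toks τ 0))
    (locate-positive τ 0 (s≤s z≤n) (toℕ<n i) [] [])

IsName⇒positive : {v : Vec ℕ n} → IsName v → All (1 ≤_) v
IsName⇒positive (τ , refl) = name-positive τ

~+-mono-≤ : ∀ N {a b} → 1 ≤ a → a ≤ b → N ~+ a ≤ N ~+ b
~+-mono-≤ N {1}           {1}           _ _ = ≤-refl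
~+-mono-≤ N {1}           {suc (suc b)} _ _ = ≤-trans (s≤s z≤n) (m≤n+m (suc (suc b)) N)
~+-mono-≤ N {suc (suc a)} {suc (suc b)} _ a≤b = +-monoʳ-≤ N a≤b
~+-mono-≤ N {suc (suc a)} {1}           _ (s≤s ())

~+-cancel-≤ : ∀ N {a b} → 1 ≤ b → N ~+ a ≤ N ~+ b → a ≤ b
~+-cancel-≤ N {zero}        {_}           _ _ = z≤n
~+-cancel-≤ N {1}           {suc b}       _ _ = s≤s z≤n
~+-cancel-≤ N {suc (suc a)} {1}           _ N+2+a≤1 =
  ⊥-elim (<-irrefl refl (≤-trans (s≤s (s≤s z≤n)) (≤-trans (m≤n+m (suc (suc a)) N) N+2+a≤1)))
~+-cancel-≤ N {suc (suc a)} {suc (suc b)} _ le = +-cancelˡ-≤ N _ _ le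

~+≤+ : ∀ N a → N ~+ a ≤ a + N
~+≤+ N zero          = ≤-reflexive (+-comm N 0)
~+≤+ N 1             = s≤s z≤n
~+≤+ N (suc (suc a)) = ≤-reflexive (+-comm N (suc (suc a)))

≤ᵛ-antisym : {xs ys : Vec ℕ n} → xs ≤ᵛ ys → ys ≤ᵛ xs → xs ≡ ys
≤ᵛ-antisym []       []       = refl
≤ᵛ-antisym (p ∷ ps) (q ∷ qs) = cong₂ _∷_ (≤-antisym p q) (≤ᵛ-antisym ps qs)

▷-mono-≤ᵛ : ∀ N {xs ys : Vec ℕ n} → All (1 ≤_) xs → xs ≤ᵛ ys → N ▷ xs ≤ᵛ N ▷ ys
▷-mono-≤ᵛ N []       []       = []
▷-mono-≤ᵛ N (q ∷ qs) (p ∷ ps) = ~+-mono-≤ N q p ∷ ▷-mono-≤ᵛ N qs ps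

▷-cancel-≤ᵛ : ∀ N {xs ys : Vec ℕ n} → All (1 ≤_) ys → N ▷ xs ≤ᵛ N ▷ ys → xs ≤ᵛ ys
▷-cancel-≤ᵛ N {[]}    []       []       = []
▷-cancel-≤ᵛ N {_ ∷ _} (q ∷ qs) (p ∷ ps) = ~+-cancel-≤ N q p ∷ ▷-cancel-≤ᵛ N qs ps

+ʳ-cancel-≤ᵛ : ∀ N {xs ys : Vec ℕ n} → map (λ a → a + N) xs ≤ᵛ map (λ a → a + N) ys → xs ≤ᵛ ys
+ʳ-cancel-≤ᵛ N {[]}    {[]}    []       = []
+ʳ-cancel-≤ᵛ N {_ ∷ _} {_ ∷ _} (p ∷ ps) = +-cancelʳ-≤ N _ _ p ∷ +ʳ-cancel-≤ᵛ N ps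

↗-≤ᵛ-↖ : (v : Vec ℕ n) (w : Vec ℕ m) → v ↗ w ≤ᵛ v ↖ w
↗-≤ᵛ-↖ {n} v w = ++⁺ (Pointwise.refl ≤-refl) (▷≤+ w)
  where
  ▷≤+ : (w : Vec ℕ m) → n ▷ w ≤ᵛ map (λ a → a + n) w
  ▷≤+ []      = []
  ▷≤+ (a ∷ w) = ~+≤+ n a ∷ ▷≤+ w

module _ {u₁ u₂ : Vec ℕ n} {v₁ v₂ : Vec ℕ m} {w₁ w₂ : Vec ℕ p} where

  ↗↖-mono-≤ᵛ : All (1 ≤_) v₁ → u₁ ≤ᵛ u₂ → v₁ ≤ᵛ v₂ → w₁ ≤ᵛ w₂ → u₁ ↗ v₁ ↖ w₁ ≤ᵛ u₂ ↗ v₂ ↖ w₂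
  ↗↖-mono-≤ᵛ v₁-pos u≤ v≤ w≤ = ++⁺ (++⁺ u≤ (▷-mono-≤ᵛ n v₁-pos v≤)) (map⁺ (+-monoˡ-≤ (n + m)) w≤)

  ↗↖-cancel-≤ᵛ : All (1 ≤_) v₂ → u₁ ↗ v₁ ↖ w₁ ≤ᵛ u₂ ↗ v₂ ↖ w₂ → u₁ ≤ᵛ u₂ × v₁ ≤ᵛ v₂ × w₁ ≤ᵛ w₂
  ↗↖-cancel-≤ᵛ v₂-pos uvw≤ =
    let uv≤ , w≤ = ++⁻ (u₁ ↗ v₁) (u₂ ↗ v₂) uvw≤
        u≤ , v≤ = ++⁻ u₁ u₂ uv≤
    in u≤ , ▷-cancel-≤ᵛ n v₂-pos v≤ , +ʳ-cancel-≤ᵛ (n + m) w≤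

↗↖-mono-<ᵛ : {u₁ u₂ : Vec ℕ n} {v₁ v₂ : Vec ℕ m} {w₁ w₂ : Vec ℕ p} → All (1 ≤_) v₁ →
             u₁ ≤ᵛ u₂ → v₁ ≤ᵛ v₂ → w₁ ≤ᵛ w₂ → (u₁ <ᵛ u₂ ⊎ v₁ <ᵛ v₂ ⊎ w₁ <ᵛ w₂) →
             u₁ ↗ v₁ ↖ w₁ <ᵛ u₂ ↗ v₂ ↖ w₂
↗↖-mono-<ᵛ {u₁ = u₁} {u₂} {v₁} {v₂} {w₁} {w₂} v₁-pos u≤ v≤ w≤ strict =
  ↗↖-mono-≤ᵛ v₁-pos u≤ v≤ w≤ , λ eq →
    all-equal strict (↗↖-cancel-≤ᵛ v₁-pos (subst (_≤ᵛ u₁ ↗ v₁ ↖ w₁) eq (Pointwise.refl ≤-refl)))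
  where
  all-equal : (u₁ <ᵛ u₂ ⊎ v₁ <ᵛ v₂ ⊎ w₁ <ᵛ w₂) → u₂ ≤ᵛ u₁ × v₂ ≤ᵛ v₁ × w₂ ≤ᵛ w₁ → ⊥
  all-equal (inj₁ (_ , u₁≢u₂))        (≥u , _ , _) = u₁≢u₂ (≤ᵛ-antisym u≤ ≥u)
  all-equal (inj₂ (inj₁ (_ , v₁≢v₂))) (_ , ≥v , _) = v₁≢v₂ (≤ᵛ-antisym v≤ ≥v)
  all-equal (inj₂ (inj₂ (_ , w₁≢w₂))) (_ , _ , ≥w) = w₁≢w₂ (≤ᵛ-antisym w≤ ≥w)

corollary3p2 : (n m p : ℕ) → 1 ≤ n → 1 ≤ m → 1 ≤ p →
    (u₁ u₂ : Vec ℕ n) (v₁ v₂ : Vec ℕ m) (w₁ w₂ : Vec ℕ p) →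
    IsName u₁ → IsName u₂ → IsName v₁ → IsName v₂ → IsName w₁ → IsName w₂ →
    ((u₁ ≤ᵛ u₂ × v₁ ≤ᵛ v₂ × w₁ ≤ᵛ w₂) ⇔ ((u₁ ↗ v₁) ↖ w₁ ≤ᵛ (u₂ ↗ v₂) ↖ w₂))
    × (u₁ ≤ᵛ u₂ → v₁ ≤ᵛ v₂ → w₁ ≤ᵛ w₂ → (u₁ <ᵛ u₂ ⊎ v₁ <ᵛ v₂ ⊎ w₁ <ᵛ w₂) →
       (u₁ ↗ v₁) ↖ w₁ <ᵛ (u₂ ↗ v₂) ↖ w₂)
    × ((v : Vec ℕ n) (w : Vec ℕ m) → IsName v → IsName w → v ↗ w ≤ᵛ v ↖ w)
corollary3p2 _ _ _ _ _ _ _ _ _ _ _ _ _ _ v₁-name v₂-name _ _ =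
  mk⇔ (λ (u≤ , v≤ , w≤) → ↗↖-mono-≤ᵛ (IsName⇒positive v₁-name) u≤ v≤ w≤)
      (↗↖-cancel-≤ᵛ (IsName⇒positive v₂-name))
  , ↗↖-mono-<ᵛ (IsName⇒positive v₁-name)
  , λ v w _ _ → ↗-≤ᵛ-↖ v w
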